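{- The LTS $(\mathrm{ACCS}/\!\equiv,\ \mathsf{Act}_\tau,\ \to/\!\equiv)$ of asynchronous CCS processes modulo structural congruence is in $\mathrm{Fdb}$, i.e. it satisfies Output-commutativity, Feedback, Output-determinacy, Output-tau, Output-confluence and Backward-output-determinacy.
   Context: Actions. Fix a countable set $\mathcal N$ of names (inputs $a,b,\dots$), co-names $\overline{\mathcal N}=\{\bar a:a\in\mathcal N\}$ (outputs) and $\tau$; $\mathsf{Act}=\mathcal N\cup\overline{\mathcal N}$ (ranged over by $\mu$), $\mathsf{Act}_\tau=\mathsf{Act}\cup\{\tau\}$ (ranged over by $\alpha$), $\bar{\bar a}=a$. ACCS. Terms: $p::=\bar a\mid g\mid p\parallel p\mid \mathrm{rec}\,x.p\mid x$ and guards $g::=\mathbf 0\mid\mathbf 1\mid a.p\mid\tau.p\mid g+g$; processes are closed terms. Transitions: $a.p\xrightarrow{a}p$; $\tau.p\xrightarrow{\tau}p$; $\bar a\xrightarrow{\bar a}\mathbf 0$; $\mathrm{rec}\,x.p\xrightarrow{\tau}p[\mathrm{rec}\,x.p/x]$; if $p\xrightarrow{\alpha}p'$ then $p+q\xrightarrow{\alpha}p'$ and $q+p\xrightarrow{\alpha}p'$; if $p\xrightarrow{\alpha}p'$ then $p\parallel q\xrightarrow{\alpha}p'\parallel q$ and $q\parallel p\xrightarrow{\alpha}q\parallel p'$; if $p\xrightarrow{\mu}p'$ and $q\xrightarrow{\bar\mu}q'$ then $p\parallel q\xrightarrow{\tau}p'\parallel q'$. ($\mathbf 0$ and $\mathbf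 1$ have no transitions.) Structural congruence $\equiv$ is the least equivalence relation with $p+\mathbf 0\equiv p$, $p+q\equiv q+p$, $(p+q)+r\equiv p+(q+r)$, $p\parallel\mathbf 0\equiv p$, $p\parallel q\equiv q\parallel p$, $(p\parallel q)\parallel r\equiv p\parallel(q\parallel r)$, closed under: $p\equiv q$ implies $\alpha.p\equiv\alpha.q$, $p+r\equiv q+r$ and $p\parallel r\equiv q\parallel r$. The quotient LTS has states the $\equiv$-classes, with $[p]\xrightarrow{\alpha}[q]$ iff $p\xrightarrow{\alpha}q'$ for some $q'\equiv q$. $\mathrm{Fdb}$ axioms (for all states and $a\in\mathcal N$): (Output-commutativity) $p\xrightarrow{\bar a}p'\xrightarrow{\alpha}q$ implies $p\xrightarrow{\alpha}p''\xrightarrow{\bar a}q$ for some $p''$; (Feedback) $p\xrightarrow{\bar a}p'\xrightarrow{a}q$ implies $p\xrightarrow{\tau}q$; (Output-determinacy) $p\xrightarrow{\bar a}p'$, $p\xrightarrow{\bar a}p''$ imply $p'=p''$; (Output-tau) $p\xrightarrow{\bar a}p'$ and $p\xrightarrow{\tau}p''$ imply either some $q$ has $p'\xrightarrow{\tau}q$ and $p''\xrightarrow{\bar a}q$, or $p'\xrightarrow{a}p''$; (Output-confluence) $p\xrightarrow{\bar a}p'$, $p\xrightarrow{\alpha}p''$, $\alpha\notin\{\bar a,\tau\}$ imply some $q$ has $p'\xrightarrow{\alpha}q$ and $p''\xrightarrow{\bar a}q$; (Backward-output-determinacy) $p'\xrightarrow{\bar a}p$ and $p''\xrightarrow{\bar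 a}p$ imply $p'=p''$. Also, the set $\{\bar a: p\xrightarrow{\bar a}\}$ is finite for every state. -}

module Defs where

open import Data.Nat using (ℕ; suc)
open import Data.Fin using (Fin; zero; suc)
open import Data.List using (List)
open import Data.List.Membership.Propositional using (_∈_)
open import Data.Product using (Σ; _×_; _,_)
open import Data.Sum using (_⊎_)
open import Relation.Binary.PropositionalEquality using (_≢_)

Name : Set
Name = ℕ

data Act : Set where
  inp  : Name → Act
  outp : Name → Act

co : Act → Act
co (inp a)  = outp a
co (outp a) = inp a

data Actτ : Set where
  act : Act → Actτ
  τ   : Actτ

-- ACCS syntax (de Bruijn; `n` = number of free recursion variables).
-- Sort G = guards, sort T = terms.  A guard is a term via `grd`.

data Sort : Set where
  G T : Sort

data Tm : Sort → ℕ → Set where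
  out  : ∀ {n} → Name → Tm T n
  grd  : ∀ {n} → Tm G n → Tm T n
  _∥_  : ∀ {n} → Tm T n → Tm T n → Tm T n
  rec  : ∀ {n} → Tm T (suc n) → Tm T n
  var  : ∀ {n} → Fin n → Tm T n
  𝟘    : ∀ {n} → Tm G n
  𝟙    : ∀ {n} → Tm G n
  _·_  : ∀ {n} → Name → Tm T n → Tm G n
  τ·_  : ∀ {n} → Tm T n → Tm G n
  _⊕_  : ∀ {n} → Tm G n → Tm G n → Tm G n

infixr 5 _∥_
infixr 6 _⊕_

Proc : Set
Proc = Tm T 0

ext : ∀ {n m} → (Fin n → Fin m) → Fin (suc n) → Fin (suc m)
ext ρ zero    = zero
ext ρ (suc i) = suc (ρ i)

rename : ∀ {s n m} → (Fin n → Fin m) → Tm s n → Tm s m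
rename ρ (out a)   = out a
rename ρ (grd g)   = grd (rename ρ g)
rename ρ (p ∥ q)   = rename ρ p ∥ rename ρ q
rename ρ (rec p)   = rec (rename (ext ρ) p)
rename ρ (var i)   = var (ρ i)
rename ρ 𝟘         = 𝟘
rename ρ 𝟙         = 𝟙
rename ρ (a · p)   = a · rename ρ p
rename ρ (τ· p)    = τ· rename ρ p
rename ρ (g ⊕ h)   = rename ρ g ⊕ rename ρ h

exts : ∀ {n m} → (Fin n → Tm T m) → Fin (suc n) → Tm T (suc m)
exts σ zero    = var zero
exts σ (suc i) = rename suc (σ i)

subst : ∀ {s n m} → (Fin n → Tm T m) → Tm s n → Tm s m
subst σ (out a)   = out a
subst σ (grd g)   = grd (subst σ g)
subst σ (p ∥ q)   = subst σ p ∥ subst σ q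
subst σ (rec p)   = rec (subst (exts σ) p)
subst σ (var i)   = σ i
subst σ 𝟘         = 𝟘
subst σ 𝟙         = 𝟙
subst σ (a · p)   = a · subst σ p
subst σ (τ· p)    = τ· subst σ p
subst σ (g ⊕ h)   = subst σ g ⊕ subst σ h

_[_] : ∀ {n} → Tm T (suc n) → Tm T n → Tm T n
p [ q ] = subst σ p
  where
    σ : _
    σ zero    = q
    σ (suc i) = var i

infix 4 _—[_]→_

data _—[_]→_ : Proc → Actτ → Proc → Set where
  inpS  : ∀ {a p} → grd (a · p) —[ act (inp a) ]→ p
  tauS  : ∀ {p} → grd (τ· p) —[ τ ]→ p
  outS  : ∀ {a} → out a —[ act (outp a) ]→ grd 𝟘
  recS  : ∀ {p} → rec p —[ τ ]→ p [ rec p ]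
  sumL  : ∀ {p q α p'} → grd p —[ α ]→ p' → grd (p ⊕ q) —[ α ]→ p'
  sumR  : ∀ {p q α p'} → grd p —[ α ]→ p' → grd (q ⊕ p) —[ α ]→ p'
  parL  : ∀ {p q α p'} → p —[ α ]→ p' → p ∥ q —[ α ]→ p' ∥ q
  parR  : ∀ {p q α p'} → p —[ α ]→ p' → q ∥ p —[ α ]→ q ∥ p'
  com   : ∀ {p q μ p' q'} → p —[ act μ ]→ p' → q —[ act (co μ) ]→ q' →
          p ∥ q —[ τ ]→ p' ∥ q'

infix 4 _≅_

data _≅_ : Proc → Proc → Set where
  ≅-refl  : ∀ {p} → p ≅ p
  ≅-sym   : ∀ {p q} → p ≅ q → q ≅ p
  ≅-trans : ∀ {p q r} → p ≅ q → q ≅ r → p ≅ r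
  sum-nil   : ∀ {p} → grd (p ⊕ 𝟘) ≅ grd p
  sum-comm  : ∀ {p q} → grd (p ⊕ q) ≅ grd (q ⊕ p)
  sum-assoc : ∀ {p q r} → grd ((p ⊕ q) ⊕ r) ≅ grd (p ⊕ (q ⊕ r))
  par-nil   : ∀ {p} → p ∥ grd 𝟘 ≅ p
  par-comm  : ∀ {p q} → p ∥ q ≅ q ∥ p
  par-assoc : ∀ {p q r} → (p ∥ q) ∥ r ≅ p ∥ (q ∥ r)
  cong-inp  : ∀ {a p q} → p ≅ q → grd (a · p) ≅ grd (a · q)
  cong-tau  : ∀ {p q} → p ≅ q → grd (τ· p) ≅ grd (τ· q)
  cong-sum  : ∀ {p q r} → grd p ≅ grd q → grd (p ⊕ r) ≅ grd (q ⊕ r)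
  cong-par  : ∀ {p q r} → p ≅ q → p ∥ r ≅ q ∥ r

-- The quotient LTS ACCS/≡ : a state [p] is represented by p, equality
-- of states is ≅, and  [p] —α→ [q]  iff  p —α→ q' for some q' ≅ q.

infix 4 _==[_]⇒_

_==[_]⇒_ : Proc → Actτ → Proc → Set
p ==[ α ]⇒ q = Σ Proc (λ q' → (p —[ α ]→ q') × (q' ≅ q))

OutputCommutativity : Set
OutputCommutativity = ∀ {p p' q} (a : Name) (α : Actτ) →
  p ==[ act (outp a) ]⇒ p' → p' ==[ α ]⇒ q →
  Σ Proc (λ p'' → (p ==[ α ]⇒ p'') × (p'' ==[ act (outp a) ]⇒ q))

Feedback : Set
Feedback = ∀ {p p' q} (a : Name) →
  p ==[ act (outp a) ]⇒ p' → p' ==[ act (inp a) ]⇒ q → p ==[ τ ]⇒ q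

OutputDeterminacy : Set
OutputDeterminacy = ∀ {p p' p''} (a : Name) →
  p ==[ act (outp a) ]⇒ p' → p ==[ act (outp a) ]⇒ p'' → p' ≅ p''

OutputTau : Set
OutputTau = ∀ {p p' p''} (a : Name) →
  p ==[ act (outp a) ]⇒ p' → p ==[ τ ]⇒ p'' →
  Σ Proc (λ q → (p' ==[ τ ]⇒ q) × (p'' ==[ act (outp a) ]⇒ q))
  ⊎ (p' ==[ act (inp a) ]⇒ p'')

OutputConfluence : Set
OutputConfluence = ∀ {p p' p''} (a : Name) (α : Actτ) →
  p ==[ act (outp a) ]⇒ p' → p ==[ α ]⇒ p'' →
  α ≢ act (outp a) → α ≢ τ →
  Σ Proc (λ q → (p' ==[ α ]⇒ q) × (p'' ==[ act (outp a) ]⇒ q))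

BackwardOutputDeterminacy : Set
BackwardOutputDeterminacy = ∀ {p p' p''} (a : Name) →
  p' ==[ act (outp a) ]⇒ p → p'' ==[ act (outp a) ]⇒ p → p' ≅ p''

FiniteOutputs : Set
FiniteOutputs = ∀ (p : Proc) → Σ (List Name) (λ L →
  ∀ (a : Name) (p' : Proc) → p ==[ act (outp a) ]⇒ p' → a ∈ L)

record InFdb : Set where
  field
    output-commutativity        : OutputCommutativity
    feedback                    : Feedback
    output-determinacy          : OutputDeterminacy
    output-tau                  : OutputTau
    output-confluence           : OutputConfluence
    backward-output-determinacy : BackwardOutputDeterminacy
    finite-outputs              : FiniteOutputs

module Submission where

-- Structural congruence is a strong bisimulation: every axiom and every
-- congruence rule is matched transition by transition, so a step of the
-- quotient LTS can be replayed from any representative of its source.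
-- The key structural fact is that an output is a top-level atom: if
-- p —ā→ p' then p ≡ p' ∥ ā.  Every Fdb axiom then follows by looking at
-- what the other transition does with the atom ā: it leaves it alone
-- (output-commutativity, -confluence, the first case of output-tau),
-- consumes it in a communication (feedback, second case of output-tau),
-- or is the ā-step itself (output-determinacy in both directions).

open import Defs
open import Data.List using (List; []; _∷_; _++_)
open import Data.List.Membership.Propositional using (_∈_)
open import Data.List.Membership.Propositional.Properties using (∈-++⁺ˡ; ∈-++⁺ʳ)
open import Data.List.Relation.Unary.Any using (here)
open import Data.Product using (Σ; _×_; _,_; proj₁; proj₂)
open import Data.Sum using (inj₁; inj₂)
open import Data.Empty using (⊥; ⊥-elim)
open import Relation.Binary.PropositionalEquality using (refl)

infix 4 _≲_

_≲_ : Proc → Proc → Set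
p ≲ q = ∀ {α p'} → p —[ α ]→ p' → Σ Proc (λ q' → (q —[ α ]→ q') × (p' ≅ q'))

≲-refl : ∀ {p} → p ≲ p
≲-refl t = _ , t , ≅-refl

≲-trans : ∀ {p q r} → p ≲ q → q ≲ r → p ≲ r
≲-trans p≲q q≲r t with p≲q t
... | _ , u , e with q≲r u
... | r' , v , e' = r' , v , ≅-trans e e'

∥-congʳ : ∀ {p q q'} → q ≅ q' → p ∥ q ≅ p ∥ q'
∥-congʳ h = ≅-trans par-comm (≅-trans (cong-par h) par-comm)

guard-¬output : ∀ {g : Tm G 0} {a p'} → grd g —[ act (outp a) ]→ p' → ⊥
guard-¬output (sumL t) = guard-¬output t
guard-¬output (sumR t) = guard-¬output t

sum-nil-≲ : ∀ {g} → grd (g ⊕ 𝟘) ≲ grd g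
sum-nil-≲ (sumL t) = _ , t , ≅-refl
sum-nil-≲ (sumR ())

sum-nil-≳ : ∀ {g} → grd g ≲ grd (g ⊕ 𝟘)
sum-nil-≳ t = _ , sumL t , ≅-refl

sum-comm-≲ : ∀ {g h} → grd (g ⊕ h) ≲ grd (h ⊕ g)
sum-comm-≲ (sumL t) = _ , sumR t , ≅-refl
sum-comm-≲ (sumR t) = _ , sumL t , ≅-refl

sum-assoc-≲ : ∀ {g h k} → grd ((g ⊕ h) ⊕ k) ≲ grd (g ⊕ (h ⊕ k))
sum-assoc-≲ (sumL (sumL t)) = _ , sumL t , ≅-refl
sum-assoc-≲ (sumL (sumR t)) = _ , sumR (sumL t) , ≅-refl
sum-assoc-≲ (sumR t)        = _ , sumR (sumR t) , ≅-refl

sum-assoc-≳ : ∀ {g h k} → grd (g ⊕ (h ⊕ k)) ≲ grd ((g ⊕ h) ⊕ k)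
sum-assoc-≳ (sumL t)        = _ , sumL (sumL t) , ≅-refl
sum-assoc-≳ (sumR (sumL t)) = _ , sumL (sumR t) , ≅-refl
sum-assoc-≳ (sumR (sumR t)) = _ , sumR t , ≅-refl

par-nil-≲ : ∀ {p} → p ∥ grd 𝟘 ≲ p
par-nil-≲ (parL t)  = _ , t , par-nil
par-nil-≲ (parR ())
par-nil-≲ (com t ())

par-nil-≳ : ∀ {p} → p ≲ p ∥ grd 𝟘
par-nil-≳ t = _ , parL t , ≅-sym par-nil

-- The communication case splits on μ so that co (co μ) reduces to μ.
par-comm-≲ : ∀ {p q} → p ∥ q ≲ q ∥ p
par-comm-≲ (parL t)                 = _ , parR t , par-comm
par-comm-≲ (parR t)                 = _ , parL t , par-comm
par-comm-≲ (com {μ = inp _} t u)  = _ , com u t , par-comm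
par-comm-≲ (com {μ = outp _} t u) = _ , com u t , par-comm

par-assoc-≲ : ∀ {p q r} → (p ∥ q) ∥ r ≲ p ∥ (q ∥ r)
par-assoc-≲ (parL (parL t))  = _ , parL t , par-assoc
par-assoc-≲ (parL (parR t))  = _ , parR (parL t) , par-assoc
par-assoc-≲ (parL (com t u)) = _ , com t (parL u) , par-assoc
par-assoc-≲ (parR t)         = _ , parR (parR t) , par-assoc
par-assoc-≲ (com (parL t) u) = _ , com t (parR u) , par-assoc
par-assoc-≲ (com (parR t) u) = _ , parR (com t u) , par-assoc

par-assoc-≳ : ∀ {p q r} → p ∥ (q ∥ r) ≲ (p ∥ q) ∥ r
par-assoc-≳ (parL t)         = _ , parL (parL t) , ≅-sym par-assoc
par-assoc-≳ (parR (parL t))  = _ , parL (parR t) , ≅-sym par-assoc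
par-assoc-≳ (parR (parR t))  = _ , parR t , ≅-sym par-assoc
par-assoc-≳ (parR (com t u)) = _ , com (parR t) u , ≅-sym par-assoc
par-assoc-≳ (com t (parL u)) = _ , parL (com t u) , ≅-sym par-assoc
par-assoc-≳ (com t (parR u)) = _ , com (parL t) u , ≅-sym par-assoc

cong-inp-≲ : ∀ {a p q} → p ≅ q → grd (a · p) ≲ grd (a · q)
cong-inp-≲ h inpS = _ , inpS , h

cong-tau-≲ : ∀ {p q} → p ≅ q → grd (τ· p) ≲ grd (τ· q)
cong-tau-≲ h tauS = _ , tauS , h

cong-sum-≲ : ∀ {g h k} → grd g ≲ grd h → grd (g ⊕ k) ≲ grd (h ⊕ k)
cong-sum-≲ g≲h (sumL t) with g≲h t
... | _ , u , e = _ , sumL u , e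
cong-sum-≲ g≲h (sumR t) = _ , sumR t , ≅-refl

cong-par-≲ : ∀ {p q r} → p ≅ q → p ≲ q → p ∥ r ≲ q ∥ r
cong-par-≲ h p≲q (parL t) with p≲q t
... | _ , u , e = _ , parL u , cong-par e
cong-par-≲ h p≲q (parR t) = _ , parR t , cong-par h
cong-par-≲ h p≲q (com t u) with p≲q t
... | _ , v , e = _ , com v u , cong-par e

≅⇒≲×≳ : ∀ {p q} → p ≅ q → p ≲ q × q ≲ p
≅⇒≲×≳ ≅-refl        = ≲-refl , ≲-refl
≅⇒≲×≳ (≅-sym h)     = proj₂ (≅⇒≲×≳ h) , proj₁ (≅⇒≲×≳ h)
≅⇒≲×≳ (≅-trans h k) =
  ≲-trans (proj₁ (≅⇒≲×≳ h)) (proj₁ (≅⇒≲×≳ k)) ,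
  ≲-trans (proj₂ (≅⇒≲×≳ k)) (proj₂ (≅⇒≲×≳ h))
≅⇒≲×≳ sum-nil       = sum-nil-≲ , sum-nil-≳
≅⇒≲×≳ sum-comm      = sum-comm-≲ , sum-comm-≲
≅⇒≲×≳ sum-assoc     = sum-assoc-≲ , sum-assoc-≳
≅⇒≲×≳ par-nil       = par-nil-≲ , par-nil-≳
≅⇒≲×≳ par-comm      = par-comm-≲ , par-comm-≲
≅⇒≲×≳ par-assoc     = par-assoc-≲ , par-assoc-≳
≅⇒≲×≳ (cong-inp h)  = cong-inp-≲ h , cong-inp-≲ (≅-sym h)
≅⇒≲×≳ (cong-tau h)  = cong-tau-≲ h , cong-tau-≲ (≅-sym h)
≅⇒≲×≳ (cong-sum h)  = cong-sum-≲ (proj₁ (≅⇒≲×≳ h)) , cong-sum-≲ (proj₂ (≅⇒≲×≳ h))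
≅⇒≲×≳ (cong-par h)  =
  cong-par-≲ h (proj₁ (≅⇒≲×≳ h)) , cong-par-≲ (≅-sym h) (proj₂ (≅⇒≲×≳ h))

≅⇒≲ : ∀ {p q} → p ≅ q → p ≲ q
≅⇒≲ h = proj₁ (≅⇒≲×≳ h)

==⇒-respˡ-≅ : ∀ {p q r α} → p ≅ q → p ==[ α ]⇒ r →
              Σ Proc (λ q' → (q —[ α ]→ q') × (q' ≅ r))
==⇒-respˡ-≅ h (_ , t , e) with ≅⇒≲ h t
... | q' , u , e' = q' , u , ≅-trans (≅-sym e') e

==⇒-resp-≅ : ∀ {p p₀ q₀ q α} → p ≅ p₀ → p₀ ==[ α ]⇒ q₀ → q₀ ≅ q → p ==[ α ]⇒ q
==⇒-resp-≅ h w e with ==⇒-respˡ-≅ (≅-sym h) w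
... | q' , u , e' = q' , u , ≅-trans e' e

—→⇒==⇒ : ∀ {p p₀ q₀ q α} → p ≅ p₀ → p₀ —[ α ]→ q₀ → q₀ ≅ q → p ==[ α ]⇒ q
—→⇒==⇒ h t = ==⇒-resp-≅ h (_ , t , ≅-refl)

output-split : ∀ {p a p'} → p —[ act (outp a) ]→ p' → p ≅ p' ∥ out a
output-split outS     = ≅-trans (≅-sym par-nil) par-comm
output-split (sumL t) = ⊥-elim (guard-¬output t)
output-split (sumR t) = ⊥-elim (guard-¬output t)
output-split (parL t) =
  ≅-trans (cong-par (output-split t))
    (≅-trans par-assoc (≅-trans (∥-congʳ par-comm) (≅-sym par-assoc)))
output-split (parR t) = ≅-trans (∥-congʳ (output-split t)) (≅-sym par-assoc)

out-residual : ∀ {p a} → p ∥ out a ==[ act (outp a) ]⇒ p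
out-residual = _ , parR outS , par-nil

swap-outputs : ∀ {l l' r r' a} → l ≅ l' ∥ out a → r ≅ r' ∥ out a → l' ∥ r ≅ l ∥ r'
swap-outputs hl hr = ≅-trans (∥-congʳ hr)
  (≅-sym (≅-trans (cong-par hl) (≅-trans par-assoc (∥-congʳ par-comm))))

—→-output-determinacy : ∀ {p a p₁ p₂} →
  p —[ act (outp a) ]→ p₁ → p —[ act (outp a) ]→ p₂ → p₁ ≅ p₂
—→-output-determinacy outS     outS     = ≅-refl
—→-output-determinacy (sumL t) _        = ⊥-elim (guard-¬output t)
—→-output-determinacy (sumR t) _        = ⊥-elim (guard-¬output t)
—→-output-determinacy (parL t) (parL u) = cong-par (—→-output-determinacy t u)
—→-output-determinacy (parR t) (parR u) = ∥-congʳ (—→-output-determinacy t u)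
—→-output-determinacy (parL t) (parR u) = swap-outputs (output-split t) (output-split u)
—→-output-determinacy (parR t) (parL u) = ≅-sym (swap-outputs (output-split u) (output-split t))

outputs : Proc → List Name
outputs (out a) = a ∷ []
outputs (p ∥ q) = outputs p ++ outputs q
outputs _       = []

∈-outputs : ∀ {p a p'} → p —[ act (outp a) ]→ p' → a ∈ outputs p
∈-outputs outS             = here refl
∈-outputs (sumL t)         = ⊥-elim (guard-¬output t)
∈-outputs (sumR t)         = ⊥-elim (guard-¬output t)
∈-outputs {p ∥ _} (parL t) = ∈-++⁺ˡ (∈-outputs t)
∈-outputs {p ∥ _} (parR t) = ∈-++⁺ʳ (outputs p) (∈-outputs t)

output-commutativity : OutputCommutativity
output-commutativity a α (_ , t , e) w with ==⇒-respˡ-≅ (≅-sym e) w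
... | q₁ , u , e' = q₁ ∥ out a , —→⇒==⇒ (output-split t) (parL u) ≅-refl ,
                    ==⇒-resp-≅ ≅-refl out-residual e'

feedback : Feedback
feedback a (_ , t , e) w with ==⇒-respˡ-≅ (≅-sym e) w
... | _ , u , e' = —→⇒==⇒ (output-split t) (com u outS) (≅-trans par-nil e')

output-determinacy : OutputDeterminacy
output-determinacy a (_ , t , e) (_ , u , e') =
  ≅-trans (≅-sym e) (≅-trans (—→-output-determinacy t u) e')

output-tau : OutputTau
output-tau a (_ , t , e) w with ==⇒-respˡ-≅ (output-split t) w
... | _ , parL u , e' =
  inj₁ (_ , —→⇒==⇒ (≅-sym e) u ≅-refl , ==⇒-resp-≅ (≅-sym e') out-residual ≅-refl)
... | _ , parR () , _
... | _ , com {μ = inp _} u outS , e' =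
  inj₂ (—→⇒==⇒ (≅-sym e) u (≅-trans (≅-sym par-nil) e'))
... | _ , com {μ = outp _} u () , _

output-confluence : OutputConfluence
output-confluence a α (_ , t , e) w α≢ā α≢τ with ==⇒-respˡ-≅ (output-split t) w
... | _ , parL u , e' = _ , —→⇒==⇒ (≅-sym e) u ≅-refl , ==⇒-resp-≅ (≅-sym e') out-residual ≅-refl
... | _ , parR outS , _ = ⊥-elim (α≢ā refl)
... | _ , com _ _ , _   = ⊥-elim (α≢τ refl)

backward-output-determinacy : BackwardOutputDeterminacy
backward-output-determinacy a (_ , t , e) (_ , u , e') =
  ≅-trans (output-split t) (≅-trans (cong-par e) (≅-sym (≅-trans (output-split u) (cong-par e'))))

lemma1 : InFdb
lemma1 = record
  { output-commutativity        = output-commutativity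
  ; feedback                    = feedback
  ; output-determinacy          = output-determinacy
  ; output-tau                  = output-tau
  ; output-confluence           = output-confluence
  ; backward-output-determinacy = backward-output-determinacy
  ; finite-outputs              = λ p → outputs p , λ _ _ (_ , t , _) → ∈-outputs t
  }
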